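{- For a path graph $P_n$ with $n\ge 3$, $$Sb_2(P_n)=\begin{cases}2, & n\equiv 0 \pmod 3,\\ 3, & \text{otherwise.}\end{cases}$$
   Context: For a graph $G=(V,E)$, $\gamma(G)$ is its domination number (minimum size of a dominating set). For a positive integer $k$, $Sb_k(G)$ is the minimum size of a set $\mathcal{E}\subseteq E$ such that $\gamma(G-\mathcal{E})=\gamma(G)+k$. -}

module Defs where

open import Data.Nat using (ℕ; zero; suc; _+_; _≤_; pred)
open import Data.Fin using (Fin; toℕ)
open import Data.Fin.Subset using (Subset; _∈_; _∉_; ∣_∣; ⊥)
open import Data.Product using (Σ; _×_; ∃; ∃-syntax)
open import Data.Sum using (_⊎_)
open import Relation.Binary.PropositionalEquality using (_≡_)

Graph : ℕ → Set₁
Graph n = Fin n → Fin n → Set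

Dominating : ∀ {n} → Graph n → Subset n → Set
Dominating {n} G D = (v : Fin n) → v ∈ D ⊎ (∃[ u ] (u ∈ D × G u v))

IsDominationNumber : ∀ {n} → Graph n → ℕ → Set
IsDominationNumber {n} G m =
  (∃[ D ] (Dominating G D × ∣ D ∣ ≡ m)) ×
  ((D : Subset n) → Dominating G D → m ≤ ∣ D ∣)

-- The path P_n on vertices 0,…,n-1 has the n-1 edges e_i = {i, i+1},
-- indexed by i : Fin (pred n).
PathMinus : (n : ℕ) → Subset (pred n) → Graph n
PathMinus n R u v =
  ∃[ e ] (e ∉ R ×
    ((toℕ u ≡ toℕ e × toℕ v ≡ suc (toℕ e)) ⊎
     (toℕ v ≡ toℕ e × toℕ u ≡ suc (toℕ e))))

Path : (n : ℕ) → Graph n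
Path n = PathMinus n ⊥

RaisesBy : (n k : ℕ) → Subset (pred n) → Set
RaisesBy n k R =
  ∃[ g ] (IsDominationNumber (Path n) g × IsDominationNumber (PathMinus n R) (g + k))

IsSbPath : (k n s : ℕ) → Set
IsSbPath k n s =
  (∃[ R ] (RaisesBy n k R × ∣ R ∣ ≡ s)) ×
  ((R : Subset (pred n)) → RaisesBy n k R → s ≤ ∣ R ∣)

-- A vertex of P_n − R dominates at most three vertices, so n ≤ 3γ(P_n − R).
-- Conversely P_n − R is a union of at most |R| + 1 paths, and taking every third
-- vertex of each gives 3γ(P_n − R) ≤ n + 2|R| + 2. Hence γ(P_n) = ⌈n/3⌉, and
-- γ(P_n − R) = γ(P_n) + 2 forces 2|R| ≥ 3⌈n/3⌉ + 4 − n, i.e. |R| ≥ 2, and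
-- |R| ≥ 3 when 3 ∤ n. Removing the first k edges isolates k vertices and leaves
-- P_{n−k}, so γ rises to k + ⌈(n − k)/3⌉: this is γ(P_n) + 2 for k = 2 when
-- 3 ∣ n and for k = 3 otherwise.

module Submission where

open import Defs
open import Data.Bool using (Bool; true; false; _∨_; _∧_; not; T)
open import Data.Bool.Properties using (T-∨)
open import Data.Empty using () renaming (⊥ to ∅)
open import Data.Fin using (Fin; zero; suc; toℕ)
open import Data.Fin.Subset using (Subset; _∈_; _∉_; ∣_∣; ⊥; inside; outside)
open import Data.Fin.Subset.Properties using (∣⊥∣≡0; ∣p∣≤∣x∷p∣)
open import Data.Nat using (ℕ; zero; suc; _+_; _*_; _≤_; _<_; _%_; pred; z≤n; s≤s)
open import Data.Nat.Properties
open import Data.Product using (_×_; _,_; proj₁; proj₂; ∃; ∃-syntax)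
import Data.Product as Product
open import Data.Sum using (_⊎_; inj₁; inj₂)
import Data.Sum as Sum
open import Data.Unit using (⊤; tt)
open import Data.Vec using ([]; _∷_; _++_; replicate)
open import Data.Vec.Base using (here; there)
open import Function using (_∘_; id)
open import Function.Bundles using (Equivalence)
open import Relation.Binary.PropositionalEquality using (_≡_; refl; sym; trans; cong; subst)
open import Relation.Nullary using (¬_; contradiction)

Dominating-mono : ∀ {n} {G H : Graph n} → (∀ {u v} → G u v → H u v) →
                  ∀ {D} → Dominating G D → Dominating H D
Dominating-mono G⇒H dom v = Sum.map₂ (Product.map₂ (Product.map₂ G⇒H)) (dom v)

IsDominationNumber-unique : ∀ {n} {G : Graph n} {a b} →
  IsDominationNumber G a → IsDominationNumber G b → a ≡ b
IsDominationNumber-unique ((A , domA , refl) , minimalA) ((B , domB , refl) , minimalB) =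
  ≤-antisym (minimalA B domB) (minimalB A domA)

+-suc-suc : ∀ m n → suc (suc (m + n)) ≡ m + suc (suc n)
+-suc-suc m n = sym (trans (+-suc m (suc n)) (cong suc (+-suc m n)))

⌈_/3⌉ : ℕ → ℕ
⌈ 0 /3⌉                 = 0
⌈ 1 /3⌉                 = 1
⌈ 2 /3⌉                 = 1
⌈ suc (suc (suc n)) /3⌉ = suc ⌈ n /3⌉

n≤⌈n/3⌉*3 : ∀ n → n ≤ ⌈ n /3⌉ * 3
n≤⌈n/3⌉*3 0                   = z≤n
n≤⌈n/3⌉*3 1                   = s≤s z≤n
n≤⌈n/3⌉*3 2                   = s≤s (s≤s z≤n)
n≤⌈n/3⌉*3 (suc (suc (suc n))) = s≤s (s≤s (s≤s (n≤⌈n/3⌉*3 n)))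

⌈n/3⌉*3≤n+2 : ∀ n → ⌈ n /3⌉ * 3 ≤ n + 2
⌈n/3⌉*3≤n+2 0                   = z≤n
⌈n/3⌉*3≤n+2 1                   = ≤-refl
⌈n/3⌉*3≤n+2 2                   = s≤s (s≤s (s≤s z≤n))
⌈n/3⌉*3≤n+2 (suc (suc (suc n))) = s≤s (s≤s (s≤s (⌈n/3⌉*3≤n+2 n)))

n%3≢0⇒n<⌈n/3⌉*3 : ∀ n → ¬ n % 3 ≡ 0 → n < ⌈ n /3⌉ * 3
n%3≢0⇒n<⌈n/3⌉*3 0                   n%3≢0 = contradiction refl n%3≢0
n%3≢0⇒n<⌈n/3⌉*3 1                   _     = s≤s (s≤s z≤n)
n%3≢0⇒n<⌈n/3⌉*3 2                   _     = ≤-refl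
n%3≢0⇒n<⌈n/3⌉*3 (suc (suc (suc n))) n%3≢0 = s≤s (s≤s (s≤s (n%3≢0⇒n<⌈n/3⌉*3 n n%3≢0)))

n%3≡0⇒⌈1+n/3⌉≡1+⌈n/3⌉ : ∀ n → n % 3 ≡ 0 → ⌈ suc n /3⌉ ≡ suc ⌈ n /3⌉
n%3≡0⇒⌈1+n/3⌉≡1+⌈n/3⌉ 0                   _     = refl
n%3≡0⇒⌈1+n/3⌉≡1+⌈n/3⌉ (suc (suc (suc n))) n%3≡0 = cong suc (n%3≡0⇒⌈1+n/3⌉≡1+⌈n/3⌉ n n%3≡0)

*3≤+2⇒≤ : ∀ {a b n} → a * 3 ≤ n + 2 → n ≤ b * 3 → a ≤ b
*3≤+2⇒≤ {a} {b} {n} a*3≤n+2 n≤b*3 = ≤-pred (*-cancelʳ-< 3 a (suc b) (begin-strict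
  a * 3     ≤⟨ a*3≤n+2 ⟩
  n + 2     ≤⟨ +-monoˡ-≤ 2 n≤b*3 ⟩
  b * 3 + 2 <⟨ s≤s (≤-reflexive (+-comm (b * 3) 2)) ⟩
  suc b * 3 ∎))
  where open ≤-Reasoning

Step : (n : ℕ) → Subset (pred n) → Fin n → Fin n → Set
Step (suc (suc n)) (c ∷ R) zero    (suc zero) = c ≡ outside
Step (suc (suc n)) (c ∷ R) (suc u) (suc v)    = Step (suc n) R u v
Step _             _       _       _          = ∅

Adjacent : (n : ℕ) → Subset (pred n) → Graph n
Adjacent n R u v = Step n R u v ⊎ Step n R v u

edge⇒Step : ∀ n R (e : Fin (pred n)) {u v} → e ∉ R →
            toℕ u ≡ toℕ e → toℕ v ≡ suc (toℕ e) → Step n R u v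
edge⇒Step (suc (suc n)) (outside ∷ R) zero {zero} {suc zero} e∉R refl refl = refl
edge⇒Step (suc (suc n)) (inside ∷ R) zero {zero} {suc zero} e∉R refl refl = contradiction here e∉R
edge⇒Step (suc (suc n)) (c ∷ R) zero {zero} {suc (suc v)} e∉R refl ()
edge⇒Step (suc (suc n)) (c ∷ R) (suc e) {suc u} {suc v} e∉R u≡e v≡1+e =
  edge⇒Step (suc n) R e (e∉R ∘ there) (suc-injective u≡e) (suc-injective v≡1+e)

Step⇒edge : ∀ n R {u v} → Step n R u v →
            ∃[ e ] (e ∉ R × toℕ u ≡ toℕ e × toℕ v ≡ suc (toℕ e))
Step⇒edge (suc (suc n)) (c ∷ R) {zero} {suc zero} refl = zero , (λ ()) , refl , refl
Step⇒edge (suc (suc n)) (c ∷ R) {suc u} {suc v} step with Step⇒edge (suc n) R step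
... | e , e∉R , u≡e , v≡1+e = suc e , (λ { (there e∈R) → e∉R e∈R }) , cong suc u≡e , cong suc v≡1+e

PathMinus⇒Adjacent : ∀ n R {u v} → PathMinus n R u v → Adjacent n R u v
PathMinus⇒Adjacent n R (e , e∉R , inj₁ (u≡e , v≡1+e)) = inj₁ (edge⇒Step n R e e∉R u≡e v≡1+e)
PathMinus⇒Adjacent n R (e , e∉R , inj₂ (v≡e , u≡1+e)) = inj₂ (edge⇒Step n R e e∉R v≡e u≡1+e)

Adjacent⇒PathMinus : ∀ n R {u v} → Adjacent n R u v → PathMinus n R u v
Adjacent⇒PathMinus n R (inj₁ step) = Product.map₂ (Product.map₂ inj₁) (Step⇒edge n R step)
Adjacent⇒PathMinus n R (inj₂ step) = Product.map₂ (Product.map₂ inj₂) (Step⇒edge n R step)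

Dominatedˡ : ∀ {n} → Bool → Graph n → Subset n → Fin n → Set
Dominatedˡ l G D v = v ∈ D ⊎ (∃[ u ] (u ∈ D × G u v)) ⊎ (T l × toℕ v ≡ 0)

Dominatingˡ : ∀ {n} → Bool → Graph n → Subset n → Set
Dominatingˡ l G D = ∀ v → Dominatedˡ l G D v

Dominating⇒Dominatingˡ : ∀ {n} {G : Graph n} {D} → Dominating G D → Dominatingˡ false G D
Dominating⇒Dominatingˡ dom v = Sum.map₂ inj₁ (dom v)

Dominatingˡ⇒Dominating : ∀ {n} {G : Graph n} {D} → Dominatingˡ false G D → Dominating G D
Dominatingˡ⇒Dominating dom v = Sum.map₂ (Sum.[ id , (λ ()) ∘ proj₁ ]) (dom v)

-- D dominates P_n − R when vertex 0 counts as dominated already if l holds;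
-- the flag passed on records whether vertex 1 is dominated by vertex 0.
Covers : ∀ {n} → Bool → Subset n → Subset (pred n) → Set
Covers l []          _       = ⊤
Covers l (x ∷ [])    []      = T (x ∨ l)
Covers l (x ∷ y ∷ D) (c ∷ R) = T (x ∨ l ∨ (not c ∧ y)) × Covers (x ∧ not c) (y ∷ D) R

Adjacent-zero : ∀ {n c R} {u : Fin (suc (suc n))} →
                Adjacent (suc (suc n)) (c ∷ R) u zero → u ≡ suc zero × c ≡ outside
Adjacent-zero {u = zero}     (inj₁ ())
Adjacent-zero {u = suc u}    (inj₁ ())
Adjacent-zero {u = suc zero} (inj₂ refl) = refl , refl

∨-introʳ : ∀ x {y} → T y → T (x ∨ y)
∨-introʳ x = Equivalence.from (T-∨ {x}) ∘ inj₂

Dominatingˡ⇒Covers : ∀ n l (D : Subset n) R → Dominatingˡ l (Adjacent n R) D → Covers l D R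
Dominatingˡ⇒Covers zero l [] [] _ = tt
Dominatingˡ⇒Covers (suc zero) l (x ∷ []) [] dom with dom zero
... | inj₁ here                         = tt
... | inj₂ (inj₁ (zero , _ , inj₁ ()))
... | inj₂ (inj₁ (zero , _ , inj₂ ()))
... | inj₂ (inj₂ (l-holds , _))         = ∨-introʳ x l-holds
Dominatingˡ⇒Covers (suc (suc n)) l (x ∷ y ∷ D) (c ∷ R) dom =
  vertex-zero (dom zero) , Dominatingˡ⇒Covers (suc n) (x ∧ not c) (y ∷ D) R rest
  where
  vertex-zero : Dominatedˡ l (Adjacent (suc (suc n)) (c ∷ R)) (x ∷ y ∷ D) zero → T (x ∨ l ∨ (not c ∧ y))
  vertex-zero (inj₁ here) = tt
  vertex-zero (inj₂ (inj₁ (u , u∈D , adj))) with Adjacent-zero {u = u} adj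
  vertex-zero (inj₂ (inj₁ (suc zero , there here , _))) | refl , refl = ∨-introʳ x (∨-introʳ l tt)
  vertex-zero (inj₂ (inj₂ (l-holds , _))) = ∨-introʳ x (Equivalence.from T-∨ (inj₁ l-holds))
  rest : Dominatingˡ (x ∧ not c) (Adjacent (suc n) R) (y ∷ D)
  rest v with dom (suc v)
  ... | inj₁ (there v∈D)                      = inj₁ v∈D
  ... | inj₂ (inj₁ (suc u , there u∈D , adj)) = inj₂ (inj₁ (u , u∈D , adj))
  ... | inj₂ (inj₁ (zero , here , adj)) with Adjacent-zero {u = suc v} (Sum.swap adj)
  ...   | refl , refl = inj₂ (inj₂ (tt , refl))

Covers⇒Dominatingˡ : ∀ n l (D : Subset n) R → Covers l D R → Dominatingˡ l (Adjacent n R) D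
Covers⇒Dominatingˡ (suc zero)    l     (inside ∷ [])           []            _        zero = inj₁ here
Covers⇒Dominatingˡ (suc zero)    true  (outside ∷ [])          []            _        zero = inj₂ (inj₂ (tt , refl))
Covers⇒Dominatingˡ (suc (suc n)) l     (inside ∷ y ∷ D)        (c ∷ R)       _        zero = inj₁ here
Covers⇒Dominatingˡ (suc (suc n)) true  (outside ∷ y ∷ D)       (c ∷ R)       _        zero = inj₂ (inj₂ (tt , refl))
Covers⇒Dominatingˡ (suc (suc n)) false (outside ∷ inside ∷ D)  (outside ∷ R) _        zero =
  inj₂ (inj₁ (suc zero , there here , inj₂ refl))
Covers⇒Dominatingˡ (suc (suc n)) false (outside ∷ inside ∷ D)  (inside ∷ R)  (() , _) zero
Covers⇒Dominatingˡ (suc (suc n)) false (outside ∷ outside ∷ D) (inside ∷ R)  (() , _) zero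
Covers⇒Dominatingˡ (suc (suc n)) false (outside ∷ outside ∷ D) (outside ∷ R) (() , _) zero
Covers⇒Dominatingˡ (suc (suc n)) l (x ∷ y ∷ D) (c ∷ R) (_ , covers) (suc v) =
  shift x c v (Covers⇒Dominatingˡ (suc n) (x ∧ not c) (y ∷ D) R covers v)
  where
  shift : ∀ x c v → Dominatedˡ (x ∧ not c) (Adjacent (suc n) R) (y ∷ D) v →
          Dominatedˡ l (Adjacent (suc (suc n)) (c ∷ R)) (x ∷ y ∷ D) (suc v)
  shift x c v (inj₁ v∈D)                    = inj₁ (there v∈D)
  shift x c v (inj₂ (inj₁ (u , u∈D , adj))) = inj₂ (inj₁ (suc u , there u∈D , adj))
  shift inside outside zero (inj₂ (inj₂ _)) = inj₂ (inj₁ (zero , here , inj₁ refl))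

Dominating⇒Covers : ∀ n R D → Dominating (PathMinus n R) D → Covers false D R
Dominating⇒Covers n R D =
  Dominatingˡ⇒Covers n false D R ∘ Dominating⇒Dominatingˡ ∘ Dominating-mono (PathMinus⇒Adjacent n R)

Covers⇒Dominating : ∀ n R D → Covers false D R → Dominating (PathMinus n R) D
Covers⇒Dominating n R D =
  Dominating-mono (Adjacent⇒PathMinus n R) ∘ Dominatingˡ⇒Dominating ∘ Covers⇒Dominatingˡ n false D R

bit : Bool → ℕ
bit false = 0
bit true  = 1

bit≤1 : ∀ b → bit b ≤ 1
bit≤1 false = z≤n
bit≤1 true  = ≤-refl

-- The term bit x strengthens the induction: a vertex of D may also dominate its right neighbour.
Covers-lower : ∀ {n} l x (D : Subset n) R → Covers l (x ∷ D) R →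
               bit x + suc n ≤ bit l + ∣ x ∷ D ∣ * 3
Covers-lower l     inside  [] [] _ = ≤-trans (s≤s (s≤s z≤n)) (m≤n+m 3 (bit l))
Covers-lower true  outside [] [] _ = ≤-refl
Covers-lower false outside [] [] ()
Covers-lower {suc n} l inside (y ∷ D) (c ∷ R) (_ , covers) =
  ≤-trans (s≤s (s≤s (≤-trans (m≤n+m (suc n) (bit y))
                    (≤-trans (Covers-lower (not c) y D R covers) (+-monoˡ-≤ _ (bit≤1 (not c)))))))
          (m≤n+m _ (bit l))
Covers-lower {suc n} true outside (y ∷ D) (c ∷ R) (_ , covers) =
  s≤s (≤-trans (m≤n+m (suc n) (bit y)) (Covers-lower false y D R covers))
Covers-lower {suc n} false outside (inside ∷ D) (outside ∷ R) (_ , covers) =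
  Covers-lower false inside D R covers

-- Greedy witness: skip a vertex already dominated, take a vertex cut off from
-- its right neighbour, and otherwise take the second vertex.
Covers-upper : ∀ {n} l (R : Subset n) →
               ∃ λ (D : Subset (suc n)) → Covers l D R × bit l + ∣ D ∣ * 3 ≤ suc n + 2 + ∣ R ∣ * 2
Covers-upper false [] = inside ∷ [] , tt , ≤-refl
Covers-upper true  [] = outside ∷ [] , tt , s≤s z≤n
Covers-upper {suc n} true (c ∷ R) with Covers-upper {n} false R
... | y ∷ D , covers , bound =
  outside ∷ y ∷ D , (tt , covers) ,
  s≤s (≤-trans bound (+-monoʳ-≤ (suc n + 2) (*-monoˡ-≤ 2 (∣p∣≤∣x∷p∣ c R))))
Covers-upper {suc n} false (inside ∷ R) with Covers-upper {n} false R
... | y ∷ D , covers , bound =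
  inside ∷ y ∷ D , (tt , covers) ,
  s≤s (s≤s (≤-trans (s≤s bound) (≤-reflexive (+-suc-suc _ _))))
Covers-upper {1} false (outside ∷ []) = inside ∷ outside ∷ [] , (tt , tt) , s≤s (s≤s (s≤s z≤n))
Covers-upper {suc (suc n)} false (outside ∷ inside ∷ R) with Covers-upper {n} false R
... | z ∷ D , covers , bound =
  outside ∷ inside ∷ z ∷ D , (tt , tt , covers) ,
  s≤s (s≤s (≤-trans (s≤s (≤-trans bound (n≤1+n _))) (≤-reflexive (+-suc-suc (suc n + 2) (∣ R ∣ * 2)))))
Covers-upper {suc (suc n)} false (outside ∷ outside ∷ R) with Covers-upper {n} true R
... | z ∷ D , covers , bound =
  outside ∷ inside ∷ z ∷ D , (tt , tt , covers) , s≤s (s≤s bound)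

domination-lower-bound : ∀ n R D → Dominating (PathMinus n R) D → n ≤ ∣ D ∣ * 3
domination-lower-bound zero    R D       _   = z≤n
domination-lower-bound (suc n) R (x ∷ D) dom =
  ≤-trans (m≤n+m (suc n) (bit x)) (Covers-lower false x D R (Dominating⇒Covers (suc n) R (x ∷ D) dom))

domination-upper-bound : ∀ n R → ∃[ D ] (Dominating (PathMinus n R) D × ∣ D ∣ * 3 ≤ n + 2 + ∣ R ∣ * 2)
domination-upper-bound zero    R = [] , (λ ()) , z≤n
domination-upper-bound (suc n) R with Covers-upper false R
... | D , covers , bound = D , Covers⇒Dominating (suc n) R D covers , bound

γ-path : ∀ n → IsDominationNumber (Path n) ⌈ n /3⌉
γ-path n with domination-upper-bound n ⊥
... | D , dom , bound = (D , dom , ∣D∣≡⌈n/3⌉) , minimal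
  where
  ∣D∣*3≤n+2 : ∣ D ∣ * 3 ≤ n + 2
  ∣D∣*3≤n+2 = ≤-trans (subst (λ r → ∣ D ∣ * 3 ≤ n + 2 + r * 2) (∣⊥∣≡0 (pred n)) bound)
                      (≤-reflexive (+-identityʳ (n + 2)))
  minimal : ∀ D′ → Dominating (Path n) D′ → ⌈ n /3⌉ ≤ ∣ D′ ∣
  minimal D′ dom′ = *3≤+2⇒≤ (⌈n/3⌉*3≤n+2 n) (domination-lower-bound n ⊥ D′ dom′)
  ∣D∣≡⌈n/3⌉ : ∣ D ∣ ≡ ⌈ n /3⌉
  ∣D∣≡⌈n/3⌉ = ≤-antisym (*3≤+2⇒≤ ∣D∣*3≤n+2 (n≤⌈n/3⌉*3 n)) (minimal D dom)

Covers-isolated⁺ : ∀ {n} {D : Subset (suc n)} {R} →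
                   Covers false D R → Covers false (inside ∷ D) (inside ∷ R)
Covers-isolated⁺ {D = y ∷ D} covers = tt , covers

Covers-isolated⁻ : ∀ {n} {x} {D : Subset (suc n)} {R} →
                   Covers false (x ∷ D) (inside ∷ R) → x ≡ inside × Covers false D R
Covers-isolated⁻ {x = inside} {D = y ∷ D} (_ , covers) = refl , covers

isolate-first-vertex : ∀ {n R g} → IsDominationNumber (PathMinus (suc n) R) g →
                       IsDominationNumber (PathMinus (suc (suc n)) (inside ∷ R)) (suc g)
isolate-first-vertex {n} {R} ((D , dom , refl) , minimal) =
  (inside ∷ D , dom⁺ , refl) , minimal′
  where
  dom⁺ : Dominating (PathMinus (suc (suc n)) (inside ∷ R)) (inside ∷ D)
  dom⁺ = Covers⇒Dominating _ _ _ (Covers-isolated⁺ {D = D} {R} (Dominating⇒Covers _ R D dom))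
  minimal′ : ∀ D′ → Dominating (PathMinus (suc (suc n)) (inside ∷ R)) D′ → suc ∣ D ∣ ≤ ∣ D′ ∣
  minimal′ (x ∷ D′) dom′ with Covers-isolated⁻ {x = x} {D′} {R} (Dominating⇒Covers _ _ (x ∷ D′) dom′)
  ... | refl , covers = s≤s (minimal D′ (Covers⇒Dominating _ R D′ covers))

firstEdges : ∀ k {m} → Subset (k + m)
firstEdges k = replicate k inside ++ ⊥

∣firstEdges∣ : ∀ k m → ∣ firstEdges k {m} ∣ ≡ k
∣firstEdges∣ zero    m = ∣⊥∣≡0 m
∣firstEdges∣ (suc k) m = cong suc (∣firstEdges∣ k m)

γ-firstEdges : ∀ k m → IsDominationNumber (PathMinus (suc (k + m)) (firstEdges k)) (k + ⌈ suc m /3⌉)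
γ-firstEdges zero    m = γ-path (suc m)
γ-firstEdges (suc k) m = isolate-first-vertex (γ-firstEdges k m)

firstEdges-raise : ∀ k m → k + ⌈ suc m /3⌉ ≡ ⌈ suc (k + m) /3⌉ + 2 →
                   RaisesBy (suc (k + m)) 2 (firstEdges k)
firstEdges-raise k m γ-eq =
  ⌈ suc (k + m) /3⌉ , γ-path (suc (k + m)) , subst (IsDominationNumber _) γ-eq (γ-firstEdges k m)

RaisesBy₂-cost : ∀ n R → RaisesBy n 2 R → (⌈ n /3⌉ + 2) * 3 ≤ n + 2 + ∣ R ∣ * 2
RaisesBy₂-cost n R (g , γ , γ-R) with domination-upper-bound n R
... | D , dom , bound rewrite IsDominationNumber-unique γ (γ-path n) =
  ≤-trans (*-monoˡ-≤ 3 (proj₂ γ-R D dom)) bound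

RaisesBy₂-edges : ∀ n k → k + n ≤ ⌈ n /3⌉ * 3 → ∀ R → RaisesBy n 2 R → k + 4 ≤ ∣ R ∣ * 2
RaisesBy₂-edges n k k+n≤⌈n/3⌉*3 R raises = ≤-pred (≤-pred (+-cancelˡ-≤ n _ _ (begin
  n + (2 + (k + 4))    ≡⟨ cong (n +_) (+-suc-suc k 4) ⟩
  n + (k + 6)          ≡⟨ sym (+-assoc n k 6) ⟩
  n + k + 6            ≡⟨ cong (_+ 6) (+-comm n k) ⟩
  k + n + 6            ≤⟨ +-monoˡ-≤ 6 k+n≤⌈n/3⌉*3 ⟩
  ⌈ n /3⌉ * 3 + 6      ≡⟨ sym (*-distribʳ-+ 3 ⌈ n /3⌉ 2) ⟩
  (⌈ n /3⌉ + 2) * 3    ≤⟨ RaisesBy₂-cost n R raises ⟩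
  n + 2 + ∣ R ∣ * 2    ≡⟨ +-assoc n 2 (∣ R ∣ * 2) ⟩
  n + (2 + ∣ R ∣ * 2)  ∎)))
  where open ≤-Reasoning

Sb₂-divisible : ∀ m → (3 + m) % 3 ≡ 0 → IsSbPath 2 (3 + m) 2
Sb₂-divisible m n%3≡0 =
  (firstEdges 2 , firstEdges-raise 2 m γ-eq , ∣firstEdges∣ 2 m) ,
  λ R raises → *-cancelʳ-≤ 2 _ 2 (RaisesBy₂-edges (3 + m) 0 (n≤⌈n/3⌉*3 (3 + m)) R raises)
  where
  γ-eq : 2 + ⌈ suc m /3⌉ ≡ ⌈ 3 + m /3⌉ + 2
  γ-eq = trans (cong (2 +_) (n%3≡0⇒⌈1+n/3⌉≡1+⌈n/3⌉ m n%3≡0)) (+-comm 2 (suc ⌈ m /3⌉))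

Sb₂-indivisible : ∀ m → ¬ (4 + m) % 3 ≡ 0 → IsSbPath 2 (4 + m) 3
Sb₂-indivisible m n%3≢0 =
  (firstEdges 3 , firstEdges-raise 3 m (cong suc (+-comm 2 ⌈ suc m /3⌉)) , ∣firstEdges∣ 3 m) ,
  λ R raises → *-cancelʳ-< 2 2 _ (RaisesBy₂-edges (4 + m) 1 (n%3≢0⇒n<⌈n/3⌉*3 (4 + m) n%3≢0) R raises)

theorem3 : (n : ℕ) → 3 ≤ n →
    ((n % 3 ≡ 0 → IsSbPath 2 n 2) × (¬ (n % 3 ≡ 0) → IsSbPath 2 n 3))
theorem3 3                         (s≤s (s≤s (s≤s _))) = Sb₂-divisible 0 , λ 3%3≢0 → contradiction refl 3%3≢0
theorem3 (suc (suc (suc (suc m)))) (s≤s (s≤s (s≤s _))) = Sb₂-divisible (suc m) , Sb₂-indivisible m
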